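{- Let $\mathbf E=(E;\oplus,',0,1)$ be a lattice effect algebra. Then $\mathbb E(\mathbb R(\mathbf E))=\mathbf E$.
   Context: An effect algebra is a partial algebra $(E;\oplus,',0,1)$ with $\oplus$ partial binary, such that: (E1) if $x\oplus y$ exists then $y\oplus x$ exists and equals it; (E2) if $x\oplus y$ and $(x\oplus y)\oplus z$ exist then $y\oplus z$ and $x\oplus(y\oplus z)$ exist and $(x\oplus y)\oplus z=x\oplus(y\oplus z)$; (E3) $x'$ is the unique element with $x\oplus x'$ defined and equal to $1$; (E4) if $x\oplus 1$ exists then $x=0$. Its induced order is $a\leq b$ iff $a\oplus c=b$ for some $c$. A lattice effect algebra is one whose induced order is a lattice, with meet $\wedge$. For a lattice effect algebra $\mathbf E$, $\mathbb R(\mathbf E)=(E;\cdot,',0,1)$ where $x\cdot y:=((x'\wedge y)\oplus y')'$. For an algebra $\mathbf R=(R;\cdot,',0,1)$ (an effect groupoid), $\mathbb E(\mathbf R)=(R;\oplus,',0,1)$ where $x\oplus y:=(x'\cdot y')'$, defined exactly when $x\cdot y=0$. Equality $\mathbb E(\mathbb R(\mathbf E))=\mathbf E$ means the partial operations coincide (same domain and values) and $'$, $0$, $1$ coincide. -}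

module Defs where

open import Data.Maybe using (Maybe; just; nothing)
open import Data.Product using (Σ; _×_; _,_)
open import Relation.Binary.PropositionalEquality using (_≡_)

-- An effect algebra (E; ⊕, ′, 0, 1).  The partial operation ⊕ is a function
-- into Maybe E: x ⊕ y ≡ nothing means "x ⊕ y is undefined".
record EffectAlgebra : Set₁ where
  field
    Carrier : Set
    _⊕_     : Carrier → Carrier → Maybe Carrier
    _′      : Carrier → Carrier
    𝟎 𝟏     : Carrier
    E1 : ∀ {x y z} → x ⊕ y ≡ just z → y ⊕ x ≡ just z
    E2 : ∀ {x y z u w} → x ⊕ y ≡ just u → u ⊕ z ≡ just w →
         Σ Carrier λ v → (y ⊕ z ≡ just v) × (x ⊕ v ≡ just w)
    E3-exists : ∀ x → x ⊕ (x ′) ≡ just 𝟏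
    E3-unique : ∀ x y → x ⊕ y ≡ just 𝟏 → y ≡ x ′
    E4 : ∀ {x z} → x ⊕ 𝟏 ≡ just z → x ≡ 𝟎

  _≤_ : Carrier → Carrier → Set
  a ≤ b = Σ Carrier λ c → a ⊕ c ≡ just b

record LatticeEffectAlgebra : Set₁ where
  field
    ea : EffectAlgebra
  open EffectAlgebra ea public
  field
    _∧_ : Carrier → Carrier → Carrier
    ∧-lb₁ : ∀ x y → (x ∧ y) ≤ x
    ∧-lb₂ : ∀ x y → (x ∧ y) ≤ y
    ∧-glb : ∀ x y z → z ≤ x → z ≤ y → z ≤ (x ∧ y)
    _∨_ : Carrier → Carrier → Carrier
    ∨-ub₁ : ∀ x y → x ≤ (x ∨ y)
    ∨-ub₂ : ∀ x y → y ≤ (x ∨ y)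
    ∨-lub : ∀ x y z → x ≤ z → y ≤ z → (x ∨ y) ≤ z

record Groupoid : Set₁ where
  field
    Carrier : Set
    _·_     : Carrier → Carrier → Carrier
    _′      : Carrier → Carrier
    𝟎 𝟏     : Carrier

-- A partial algebra (R; ⊕, ′, 0, 1), with ⊕ given by its graph:
-- Sum x y z means "x ⊕ y is defined and equals z".
record PartialAlgebra : Set₁ where
  field
    Carrier : Set
    Sum     : Carrier → Carrier → Carrier → Set
    _′      : Carrier → Carrier
    𝟎 𝟏     : Carrier

fromMaybe : {A : Set} → A → Maybe A → A
fromMaybe d (just a) = a
fromMaybe d nothing  = d

-- ℝ(E): x · y := ((x′ ∧ y) ⊕ y′)′.  In a lattice effect algebra
-- (x′ ∧ y) ⊕ y′ is always defined (since x′ ∧ y ≤ y); the default 𝟎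
-- for the undefined case is never used.
ℝ : LatticeEffectAlgebra → Groupoid
ℝ L = record
  { Carrier = Carrier
  ; _·_ = λ x y → fromMaybe 𝟎 (((x ′) ∧ y) ⊕ (y ′)) ′
  ; _′ = _′
  ; 𝟎 = 𝟎
  ; 𝟏 = 𝟏
  }
  where open LatticeEffectAlgebra L

𝔼 : Groupoid → PartialAlgebra
𝔼 R = record
  { Carrier = Carrier
  ; Sum = λ x y z → (x · y ≡ 𝟎) × (z ≡ ((x ′) · (y ′)) ′)
  ; _′ = _′
  ; 𝟎 = 𝟎
  ; 𝟏 = 𝟏
  }
  where open Groupoid R

-- 𝔼(ℝ(E)) = E: the partial operations coincide (same domain and same
-- values), and ′, 0, 1 coincide.  The carrier of 𝔼 (ℝ L) is definitionally
-- the carrier of L.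
𝔼ℝ-equals : LatticeEffectAlgebra → Set
𝔼ℝ-equals L =
    (∀ x y z → (P.Sum x y z → x ⊕ y ≡ just z) × (x ⊕ y ≡ just z → P.Sum x y z))
  × (∀ x → x P.′ ≡ x ′)
  × (P.𝟎 ≡ 𝟎)
  × (P.𝟏 ≡ 𝟏)
  where
    open LatticeEffectAlgebra L
    module P = PartialAlgebra (𝔼 (ℝ L))

module Submission where

-- Write x · y = ((x′ ∧ y) ⊕ y′)′ for the product of ℝ(E); the
-- sum (x′ ∧ y) ⊕ y′ always exists because x′ ∧ y ≤ y and y ⊕ y′ = 1.
--   (1) x · y = 0  iff  y ≤ x′, i.e. iff x ⊕ y is defined in E: the product
--       vanishes exactly when (x′ ∧ y) ⊕ y′ = 1, i.e. when x′ ∧ y = y.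
--   (2) If x ⊕ y is defined then x ≤ y′, hence x ∧ y′ = x and
--       (x′ · y′)′ = (x ∧ y′) ⊕ y = x ⊕ y.
-- So the partial sum of 𝔼(ℝ(E)) has the same domain and values as ⊕, while
-- ′, 0 and 1 are unchanged by construction.

open import Defs
open import Data.Maybe using (just)
open import Data.Maybe.Properties using (just-injective)
open import Data.Product using (Σ; _×_; _,_)
open import Relation.Binary.PropositionalEquality
open ≡-Reasoning

module EffectAlgebraFacts (E : EffectAlgebra) where
  open EffectAlgebra E

  -- x is the complement of x′, by (E1) and uniqueness in (E3).
  ′-involutive : ∀ x → x ′ ′ ≡ x
  ′-involutive x = sym (E3-unique (x ′) x (E1 (E3-exists x)))

  ′-injective : ∀ {x y} → x ′ ≡ y ′ → x ≡ y
  ′-injective {x} {y} eq = begin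
    x      ≡⟨ ′-involutive x ⟨
    x ′ ′  ≡⟨ cong _′ eq ⟩
    y ′ ′  ≡⟨ ′-involutive y ⟩
    y      ∎

  -- 1′ ⊕ 1 is defined, so 1′ = 0 by (E4).
  𝟏′≡𝟎 : 𝟏 ′ ≡ 𝟎
  𝟏′≡𝟎 = E4 (E1 (E3-exists 𝟏))

  𝟎′≡𝟏 : 𝟎 ′ ≡ 𝟏
  𝟎′≡𝟏 = begin
    𝟎 ′    ≡⟨ cong _′ 𝟏′≡𝟎 ⟨
    𝟏 ′ ′  ≡⟨ ′-involutive 𝟏 ⟩
    𝟏      ∎

  𝟏⊕𝟎 : 𝟏 ⊕ 𝟎 ≡ just 𝟏
  𝟏⊕𝟎 = subst (λ t → 𝟏 ⊕ t ≡ just 𝟏) 𝟏′≡𝟎 (E3-exists 𝟏)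

  -- 0 is a right unit: associate (x′ ⊕ x) ⊕ 0 = 1 and read off x ⊕ 0 as
  -- the complement of x′.
  ⊕-identityʳ : ∀ x → x ⊕ 𝟎 ≡ just x
  ⊕-identityʳ x with E2 (E1 (E3-exists x)) 𝟏⊕𝟎
  ... | v , x⊕𝟎≡v , x′⊕v≡𝟏 =
    subst (λ t → x ⊕ 𝟎 ≡ just t)
          (trans (E3-unique (x ′) v x′⊕v≡𝟏) (′-involutive x)) x⊕𝟎≡v

  -- Cancellation: b and c are both the complement of a ⊕ d′.
  ⊕-cancelˡ : ∀ {a b c d} → a ⊕ b ≡ just d → a ⊕ c ≡ just d → b ≡ c
  ⊕-cancelˡ {a} {b} {c} {d} a⊕b≡d a⊕c≡d
    with E2 (E1 a⊕b≡d) (E3-exists d) | E2 (E1 a⊕c≡d) (E3-exists d)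
  ... | v , a⊕d′≡v , b⊕v≡𝟏 | w , a⊕d′≡w , c⊕w≡𝟏 = begin
    b    ≡⟨ E3-unique v b (E1 b⊕v≡𝟏) ⟩
    v ′  ≡⟨ cong _′ (just-injective (trans (sym a⊕d′≡v) a⊕d′≡w)) ⟩
    w ′  ≡⟨ E3-unique w c (E1 c⊕w≡𝟏) ⟨
    c    ∎

  -- Positivity: if c ⊕ d = 0 then c ⊕ 1 = c ⊕ (d ⊕ 1) is defined, so c = 0.
  ⊕-positive : ∀ {c d} → c ⊕ d ≡ just 𝟎 → c ≡ 𝟎
  ⊕-positive c⊕d≡𝟎 with E2 (E1 c⊕d≡𝟎) (E1 𝟏⊕𝟎)
  ... | _ , c⊕𝟏≡v , _ = E4 c⊕𝟏≡v

  ≤-refl : ∀ x → x ≤ x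
  ≤-refl x = 𝟎 , ⊕-identityʳ x

  -- If a ⊕ c = b and b ⊕ d = a then a ⊕ (c ⊕ d) = a, so c ⊕ d = 0 and c = 0.
  ≤-antisym : ∀ {a b} → a ≤ b → b ≤ a → a ≡ b
  ≤-antisym {a} {b} (c , a⊕c≡b) (d , b⊕d≡a) with E2 a⊕c≡b b⊕d≡a
  ... | v , c⊕d≡v , a⊕v≡a with ⊕-cancelˡ a⊕v≡a (⊕-identityʳ a)
  ... | refl with ⊕-positive c⊕d≡v
  ... | refl = just-injective (trans (sym (⊕-identityʳ a)) a⊕c≡b)

  ⊕-defined-below : ∀ {a b d e} → a ≤ b → b ⊕ d ≡ just e →
                    Σ Carrier λ v → a ⊕ d ≡ just v
  ⊕-defined-below (c , a⊕c≡b) b⊕d≡e with E2 (E1 a⊕c≡b) b⊕d≡e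
  ... | v , a⊕d≡v , _ = v , a⊕d≡v

  -- A summand lies below the complement of the other summand:
  -- a ⊕ (c ⊕ c′) = 1 shows a ⊕ c′ is the complement of b.
  summand≤complement : ∀ {a b c} → a ⊕ b ≡ just c → a ≤ (b ′)
  summand≤complement {a} {b} {c} a⊕b≡c with E2 (E1 a⊕b≡c) (E3-exists c)
  ... | v , a⊕c′≡v , b⊕v≡𝟏 =
    c ′ , subst (λ t → a ⊕ (c ′) ≡ just t) (E3-unique b v b⊕v≡𝟏) a⊕c′≡v

  ⊕-defined-if-≤′ : ∀ {x y} → y ≤ (x ′) → Σ Carrier λ z → x ⊕ y ≡ just z
  ⊕-defined-if-≤′ {x} y≤x′ with ⊕-defined-below y≤x′ (E1 (E3-exists x))
  ... | z , y⊕x≡z = z , E1 y⊕x≡z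

module LatticeFacts (L : LatticeEffectAlgebra) where
  open LatticeEffectAlgebra L
  open EffectAlgebraFacts ea

  ∧-eqˡ : ∀ {x y} → x ≤ y → x ∧ y ≡ x
  ∧-eqˡ {x} {y} x≤y = ≤-antisym (∧-lb₁ x y) (∧-glb x y x (≤-refl x) x≤y)

  ∧-eqʳ : ∀ {x y} → y ≤ x → x ∧ y ≡ y
  ∧-eqʳ {x} {y} y≤x = ≤-antisym (∧-lb₂ x y) (∧-glb x y y y≤x (≤-refl y))

  _·_ : Carrier → Carrier → Carrier
  _·_ = Groupoid._·_ (ℝ L)

  ·-sum-defined : ∀ x y → Σ Carrier λ s → ((x ′) ∧ y) ⊕ (y ′) ≡ just s
  ·-sum-defined x y = ⊕-defined-below (∧-lb₂ (x ′) y) (E3-exists y)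

  ·-value : ∀ {x y s} → ((x ′) ∧ y) ⊕ (y ′) ≡ just s → x · y ≡ s ′
  ·-value eq = cong (λ m → fromMaybe 𝟎 m ′) eq

  -- If y ≤ x′ then x′ ∧ y = y, and x · y = (y ⊕ y′)′ = 1′ = 0.
  ·≡𝟎-if-≤′ : ∀ {x y} → y ≤ (x ′) → x · y ≡ 𝟎
  ·≡𝟎-if-≤′ {x} {y} y≤x′ = begin
    x · y  ≡⟨ ·-value sum≡𝟏 ⟩
    𝟏 ′    ≡⟨ 𝟏′≡𝟎 ⟩
    𝟎      ∎
    where
    sum≡𝟏 : ((x ′) ∧ y) ⊕ (y ′) ≡ just 𝟏
    sum≡𝟏 = subst (λ m → m ⊕ (y ′) ≡ just 𝟏) (sym (∧-eqʳ y≤x′)) (E3-exists y)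

  -- If x · y = 0 then (x′ ∧ y) ⊕ y′ = 1, so x′ ∧ y is the complement of y′,
  -- i.e. x′ ∧ y = y, whence y ≤ x′.
  ≤′-if-·≡𝟎 : ∀ {x y} → x · y ≡ 𝟎 → y ≤ (x ′)
  ≤′-if-·≡𝟎 {x} {y} x·y≡𝟎 with ·-sum-defined x y
  ... | s , sum≡s = subst (λ m → m ≤ (x ′)) meet≡y (∧-lb₁ (x ′) y)
    where
    s≡𝟏 : s ≡ 𝟏
    s≡𝟏 = begin
      s      ≡⟨ ′-involutive s ⟨
      s ′ ′  ≡⟨ cong _′ (trans (sym (·-value sum≡s)) x·y≡𝟎) ⟩
      𝟎 ′    ≡⟨ 𝟎′≡𝟏 ⟩
      𝟏      ∎
    meet≡y : (x ′) ∧ y ≡ y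
    meet≡y = ′-injective (sym (E3-unique _ (y ′)
               (subst (λ t → ((x ′) ∧ y) ⊕ (y ′) ≡ just t) s≡𝟏 sum≡s)))

  -- If x ⊕ y = z then x ≤ y′, so (x′ · y′)′ = (x ∧ y′) ⊕ y = x ⊕ y = z.
  ·-complement-sum : ∀ {x y z} → x ⊕ y ≡ just z → ((x ′) · (y ′)) ′ ≡ z
  ·-complement-sum {x} {y} {z} x⊕y≡z = begin
    ((x ′) · (y ′)) ′                                ≡⟨ ′-involutive _ ⟩
    fromMaybe 𝟎 (((x ′ ′) ∧ (y ′)) ⊕ (y ′ ′))        ≡⟨ cong₂ (λ a b → fromMaybe 𝟎 (a ⊕ b)) meet≡x (′-involutive y) ⟩
    fromMaybe 𝟎 (x ⊕ y)                              ≡⟨ cong (fromMaybe 𝟎) x⊕y≡z ⟩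
    z                                                ∎
    where
    meet≡x : (x ′ ′) ∧ (y ′) ≡ x
    meet≡x = trans (cong (_∧ (y ′)) (′-involutive x))
                   (∧-eqˡ (summand≤complement x⊕y≡z))

  𝔼ℝ-sum-sound : ∀ {x y z} → x · y ≡ 𝟎 → z ≡ ((x ′) · (y ′)) ′ →
                 x ⊕ y ≡ just z
  𝔼ℝ-sum-sound {x} {y} {z} x·y≡𝟎 z≡ with ⊕-defined-if-≤′ (≤′-if-·≡𝟎 x·y≡𝟎)
  ... | w , x⊕y≡w =
    subst (λ t → x ⊕ y ≡ just t) (sym (trans z≡ (·-complement-sum x⊕y≡w))) x⊕y≡w

  𝔼ℝ-sum-complete : ∀ {x y z} → x ⊕ y ≡ just z →
                    (x · y ≡ 𝟎) × (z ≡ ((x ′) · (y ′)) ′)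
  𝔼ℝ-sum-complete x⊕y≡z =
    ·≡𝟎-if-≤′ (summand≤complement (E1 x⊕y≡z)) , sym (·-complement-sum x⊕y≡z)

mainTheorem3 : (L : LatticeEffectAlgebra) → 𝔼ℝ-equals L
mainTheorem3 L =
    (λ x y z → (λ { (x·y≡𝟎 , z≡) → 𝔼ℝ-sum-sound x·y≡𝟎 z≡ }) , 𝔼ℝ-sum-complete)
  , (λ x → refl) , refl , refl
  where open LatticeFacts L
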